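{- The map $\operatorname{Li}^{q}$ is a $\mathcal{C}$-algebra homomorphism, i.e. $\operatorname{Li}^q_w(z)\operatorname{Li}^q_v(z)=\operatorname{Li}^q_{w\mathbin{\sqcup\!\sqcup}_q v}(z)$ for $w,v\in\widehat{\mathfrak{H}}^1$.
   Context: Let $\mathcal{C}=\mathbb{Q}[\hbar,\hbar^{ -1}]$, $\widehat{\mathfrak{H}}=\mathcal{C}\langle a,b\rangle$, $\widehat{\mathfrak{H}}^1=\mathcal{C}+\widehat{\mathfrak{H}}b$, $e_k=a^kb$. $\mathbb{Q}[[q,z]]$ is a $\mathcal{C}$-algebra with $\hbar$ acting as $1-q$. $[m]_q=(1-q^m)/(1-q)$. The $\mathcal{C}$-linear map $\operatorname{Li}^q:\widehat{\mathfrak{H}}^1\to\mathbb{Q}[[q,z]]$ sends $e_{k_1}\cdots e_{k_r}$ to $\operatorname{Li}^q_{k_1,\dots,k_r}(z)=\sum_{m_1>\cdots>m_r>0}z^{m_1}\prod_{j=1}^r\frac{q^{k_jm_j}}{[m_j]_q^{k_j}}$, and the empty word to $1$. The $q$-shuffle product $\mathbin{\sqcup\!\sqcup}_q$ is defined for letters $\alpha,\beta\in\{a,b\}$ and words $w,v$ by $\alpha w\mathbin{\sqcup\!\sqcup}_q\beta v=\alpha(w\mathbin{\sqcup\!\sqcup}_q\beta v)+\beta(\alpha w\mathbin{\sqcup\!\sqcup}_q v)+(\alpha\diamond_q\beta)(w\mathbin{\sqcup\!\sqcup}_q v)$, ${\bf 1}$ being the unit, where $a\diamond_qb=b\diamond_qa=-ab$,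 $b\diamond_qb=-bb$, $a\diamond_qa=\hbar a$. -}

module Defs where

open import Data.Nat using (ℕ; zero; suc; _∸_; _*_)
open import Data.Integer using (ℤ; +_; -[1+_]) renaming (_+_ to _+ℤ_)
open import Data.Rational using (ℚ; 0ℚ; 1ℚ; _+_; -_) renaming (_*_ to _·_)
open import Data.List using (List; []; _∷_; _++_; map; foldr; upTo; zipWith; concatMap)
open import Data.Maybe using (Maybe; just; nothing)
open import Data.Product using (_×_; _,_)
open import Relation.Binary.PropositionalEquality using (_≡_)

-- Formal power series in q with rational coefficients: n ↦ coeff of q^n

QS : Set
QS = ℕ → ℚ

sumTo : ℕ → (ℕ → ℚ) → ℚ
sumTo zero f = f zero
sumTo (suc n) f = sumTo n f + f (suc n)

zeroS oneS : QS
zeroS _ = 0ℚ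
oneS zero = 1ℚ
oneS (suc _) = 0ℚ

_+S_ : QS → QS → QS
(f +S g) n = f n + g n

_*S_ : QS → QS → QS
(f *S g) n = sumTo n (λ i → f i · g (n ∸ i))

powS : QS → ℕ → QS
powS f zero = oneS
powS f (suc k) = f *S powS f k

scaleS : ℚ → QS → QS
scaleS c f n = c · f n

sumS : List QS → QS
sumS = foldr _+S_ zeroS

qmono : ℕ → QS
qmono zero = oneS
qmono (suc m) zero = 0ℚ
qmono (suc m) (suc n) = qmono m n

-- [m]_q = 1 + q + ... + q^(m-1)
qint : ℕ → QS
qint zero _ = 0ℚ
qint (suc m) zero = 1ℚ
qint (suc m) (suc n) = qint m n

-- multiplicative inverse of a power series with constant term 1:
-- g_0 = 1, g_{n+1} = - Σ_{k=1}^{n+1} f_k g_{n+1-k}.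
-- invList f n = [g_n , ... , g_0]
invList : QS → ℕ → List ℚ
invList f zero = 1ℚ ∷ []
invList f (suc n) =
  (- foldr _+_ 0ℚ (zipWith _·_ (map (λ k → f (suc k)) (upTo (suc n))) prev)) ∷ prev
  where prev = invList f n

invS : QS → QS
invS f n with invList f n
... | x ∷ _ = x
... | []    = 0ℚ

-- Formal power series in q and z: N ↦ coefficient of z^N (a q-series).
-- Q[[q,z]] ≅ Q[[q]][[z]].

PS : Set
PS = ℕ → QS

zeroP : PS
zeroP _ = zeroS

_+P_ : PS → PS → PS
(F +P G) N = F N +S G N

_*P_ : PS → PS → PS
(F *P G) N = λ n → sumTo N (λ j → (F j *S G (N ∸ j)) n)

sumP : List PS → PS
sumP = foldr _+P_ zeroP

_≈P_ : PS → PS → Set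
F ≈P G = ∀ N n → F N n ≡ G N n

-- The coefficient ring C = Q[ħ, ħ⁻¹] acting on Q[[q,z]] via ħ ↦ 1 - q.
-- A monomial c ħ^e (e ∈ ℤ, c ∈ ℚ) acts as multiplication by c (1-q)^e,
-- where (1-q)^{-1} is the inverse power series of 1 - q.

oneMinusQ : QS
oneMinusQ zero = 1ℚ
oneMinusQ (suc zero) = - 1ℚ
oneMinusQ (suc (suc _)) = 0ℚ

hbarPow : ℤ → QS
hbarPow (+ n) = powS oneMinusQ n
hbarPow -[1+ n ] = powS (invS oneMinusQ) (suc n)

actP : ℤ → ℚ → PS → PS
actP e c F N = scaleS c (hbarPow e *S F N)

-- Words.  Letters a, b; ABWord = words in {a,b}.
-- An element of Ĥ (resp. Ĥ¹) is represented as a finite C-linear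
-- combination  Σ c_i ħ^{e_i} w_i , i.e. a list of terms (e_i , c_i , w_i).

data Letter : Set where
  a b : Letter

ABWord : Set
ABWord = List Letter

-- Ĥ¹-words e_{k_1} ⋯ e_{k_r}, with e_k = a^k b, encoded by (k_1,…,k_r);
-- [] is the empty word 1.
H1Word : Set
H1Word = List ℕ

eWord : ℕ → ABWord
eWord zero = b ∷ []
eWord (suc k) = a ∷ eWord k

toAB : H1Word → ABWord
toAB [] = []
toAB (k ∷ ks) = eWord k ++ toAB ks

parseGo : ℕ → ABWord → Maybe H1Word
parseGo zero [] = just []
parseGo (suc n) [] = nothing
parseGo n (a ∷ w) = parseGo (suc n) w
parseGo n (b ∷ w) with parseGo zero w
... | just ks = just (n ∷ ks)
... | nothing = nothing

parse : ABWord → Maybe H1Word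
parse = parseGo zero

Lin : Set → Set
Lin W = List (ℤ × ℚ × W)

prefixL : ABWord → Lin ABWord → Lin ABWord
prefixL u = map (λ { (e , c , w) → (e , c , (u ++ w)) })

negL : Lin ABWord → Lin ABWord
negL = map (λ { (e , c , w) → (e , - c , w) })

hbarL : Lin ABWord → Lin ABWord
hbarL = map (λ { (e , c , w) → (e +ℤ + 1 , c , w) })

diamond : Letter → Letter → Lin ABWord → Lin ABWord
diamond a a X = prefixL (a ∷ []) (hbarL X)
diamond a b X = negL (prefixL (a ∷ b ∷ []) X)
diamond b a X = negL (prefixL (a ∷ b ∷ []) X)
diamond b b X = negL (prefixL (b ∷ b ∷ []) X)

shq : ABWord → ABWord → Lin ABWord
shq [] v = (+ 0 , 1ℚ , v) ∷ []
shq (α ∷ w) [] = (+ 0 , 1ℚ , (α ∷ w)) ∷ []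
shq (α ∷ w) (β ∷ v) =
  prefixL (α ∷ []) (shq w (β ∷ v)) ++
  prefixL (β ∷ []) (shq (α ∷ w) v) ++
  diamond α β (shq w v)

shqLin : Lin H1Word → Lin H1Word → Lin ABWord
shqLin X Y = concatMap (λ { (e₁ , c₁ , w) →
               concatMap (λ { (e₂ , c₂ , v) →
                 map (λ { (e , c , u) → (e₁ +ℤ e₂ +ℤ e , c₁ · c₂ · c , u) })
                     (shq (toAB w) (toAB v)) }) Y }) X

-- q-polylogarithms
-- Li^q_{k_1,…,k_r}(z) = Σ_{m_1>⋯>m_r>0} z^{m_1} Π_j q^{k_j m_j} / [m_j]_q^{k_j}

factor : ℕ → ℕ → QS
factor k m = qmono (k * m) *S powS (invS (qint m)) k

tailSum : List ℕ → ℕ → QS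
tailSum [] M = oneS
tailSum (k ∷ ks) M =
  sumS (map (λ m → factor k m *S tailSum ks m) (map suc (upTo (M ∸ 1))))

LiWord : H1Word → PS
LiWord [] zero = oneS
LiWord [] (suc _) = zeroS
LiWord (k ∷ ks) zero = zeroS
LiWord (k ∷ ks) (suc n) = factor k (suc n) *S tailSum ks (suc n)

-- Li^q on an {a,b}-word (only meaningful on Ĥ¹-words; 0 otherwise)
LiAB : ABWord → PS
LiAB w with parse w
... | just ks = LiWord ks
... | nothing = zeroP

LiLin : {W : Set} → (W → PS) → Lin W → PS
LiLin L X = sumP (map (λ { (e , c , w) → actP e c (L w) }) X)

Liq : Lin H1Word → PS
Liq = LiLin LiWord

-- Let A act on ℚ[[q,z]] by multiplying the coefficient of z^N by q^N/[N]_q and let B be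
-- multiplication by z/(1-z). Then Li^q_{e_{k₁}⋯e_{k_r}} = A^{k₁} B ⋯ A^{k_r} B 1, so reading a
-- word letter by letter turns the product formula, by induction on both words, into one
-- identity per pair of leading letters. Whenever a b is involved, that identity only uses
-- commutativity. For two a's it is A X · A Y = A (X · A Y) + A (A X · Y) + ħ A (X Y), which holds
-- coefficientwise because [i + j]_q = q^i [j]_q + q^j [i]_q + (1 - q) [i]_q [j]_q. Bilinearity
-- extends the identity from words to Ĥ¹.

module Submission where

open import Algebra using (CommutativeRing)
open import Algebra.Morphism.Structures using (module MonoidMorphisms)
import Algebra.Morphism.Construct.Composition as Composition
import Algebra.Morphism.Construct.Identity as Identity
import Algebra.Properties.CommutativeSemiring.Exp as CommutativeSemiringExp
import Algebra.Properties.Ring as RingProperties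
import Algebra.Properties.Semiring.Exp as SemiringExp
import Algebra.Solver.Ring.NaturalCoefficients.Default as NaturalSolver
open import Data.Integer as ℤ using (ℤ; +_; -[1+_]; _⊖_)
import Data.Integer.Properties as ℤₚ
open import Data.List using ([]; _∷_; _++_; map; foldr; upTo; applyUpTo; zipWith; concatMap; replicate)
open import Data.List.Properties using (map-upTo; map-applyUpTo)
open import Data.Maybe using (just; nothing; maybe′)
open import Data.Nat as ℕ using (ℕ; zero; suc; _∸_; _≤_; z≤n)
import Data.Nat.Properties as ℕₚ
open import Data.Product using (_×_; _,_)
open import Data.Rational as ℚ using (ℚ; 0ℚ; 1ℚ)
import Data.Rational.Properties as ℚₚ
open import Data.Unit using (⊤; tt)
open import Function using (_∘_)
open import Relation.Binary.PropositionalEquality as ≡ using (_≡_)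
import Relation.Binary.Reasoning.Setoid as SetoidReasoning

open import Defs

module PowerSeries {c ℓ} (R : CommutativeRing c ℓ) where
  open CommutativeRing R hiding (zero)
  open RingProperties ring using (-0#≈0#)
  open SetoidReasoning setoid

  Series : Set c
  Series = ℕ → Carrier

  infix 4 _≋_
  _≋_ : Series → Series → Set ℓ
  f ≋ g = ∀ n → f n ≈ g n

  Σ≤ : ℕ → (ℕ → Carrier) → Carrier
  Σ≤ zero    f = f zero
  Σ≤ (suc n) f = Σ≤ n f + f (suc n)

  infix  8 ⊝_
  infixl 7 _⊛_
  infixl 6 _⊕_

  _⊕_ _⊛_ : Series → Series → Series
  (f ⊕ g) n = f n + g n
  (f ⊛ g) n = Σ≤ n (λ i → f i * g (n ∸ i))

  ⊝_ : Series → Series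
  (⊝ f) n = - f n

  constant : Carrier → Series
  constant x zero    = x
  constant x (suc _) = 0#

  𝟘 𝟙 : Series
  𝟘 _ = 0#
  𝟙 = constant 1#

  Σ≤-congᵇ : ∀ n {f g} → (∀ i → i ≤ n → f i ≈ g i) → Σ≤ n f ≈ Σ≤ n g
  Σ≤-congᵇ zero    f≈g = f≈g 0 z≤n
  Σ≤-congᵇ (suc n) f≈g =
    +-cong (Σ≤-congᵇ n (λ i i≤n → f≈g i (ℕₚ.m≤n⇒m≤1+n i≤n))) (f≈g (suc n) ℕₚ.≤-refl)

  Σ≤-cong : ∀ n {f g} → (∀ i → f i ≈ g i) → Σ≤ n f ≈ Σ≤ n g
  Σ≤-cong n f≈g = Σ≤-congᵇ n (λ i _ → f≈g i)

  Σ≤-distrib-+ : ∀ n f g → Σ≤ n (λ i → f i + g i) ≈ Σ≤ n f + Σ≤ n g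
  Σ≤-distrib-+ zero    f g = refl
  Σ≤-distrib-+ (suc n) f g = begin
    Σ≤ n (λ i → f i + g i) + (f (suc n) + g (suc n)) ≈⟨ +-congʳ (Σ≤-distrib-+ n f g) ⟩
    (Σ≤ n f + Σ≤ n g) + (f (suc n) + g (suc n))       ≈⟨ +-assoc _ _ _ ⟩
    Σ≤ n f + (Σ≤ n g + (f (suc n) + g (suc n)))       ≈⟨ +-congˡ (+-comm _ _) ⟩
    Σ≤ n f + ((f (suc n) + g (suc n)) + Σ≤ n g)       ≈⟨ +-congˡ (+-assoc _ _ _) ⟩
    Σ≤ n f + (f (suc n) + (g (suc n) + Σ≤ n g))       ≈⟨ +-congˡ (+-congˡ (+-comm _ _)) ⟩
    Σ≤ n f + (f (suc n) + (Σ≤ n g + g (suc n)))       ≈⟨ +-assoc _ _ _ ⟨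
    (Σ≤ n f + f (suc n)) + (Σ≤ n g + g (suc n))       ∎

  *-distribˡ-Σ≤ : ∀ n x f → x * Σ≤ n f ≈ Σ≤ n (λ i → x * f i)
  *-distribˡ-Σ≤ zero    x f = refl
  *-distribˡ-Σ≤ (suc n) x f = trans (distribˡ _ _ _) (+-congʳ (*-distribˡ-Σ≤ n x f))

  *-distribʳ-Σ≤ : ∀ n x f → Σ≤ n f * x ≈ Σ≤ n (λ i → f i * x)
  *-distribʳ-Σ≤ n x f =
    trans (*-comm _ _) (trans (*-distribˡ-Σ≤ n x f) (Σ≤-cong n (λ i → *-comm _ _)))

  Σ≤-suc : ∀ n f → Σ≤ (suc n) f ≈ f 0 + Σ≤ n (f ∘ suc)
  Σ≤-suc zero    f = refl
  Σ≤-suc (suc n) f = trans (+-congʳ (Σ≤-suc n f)) (+-assoc _ _ _)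

  Σ≤-head : ∀ n f → (∀ i → f (suc i) ≈ 0#) → Σ≤ n f ≈ f 0
  Σ≤-head zero    f f₊≈0 = refl
  Σ≤-head (suc n) f f₊≈0 = trans (+-cong (Σ≤-head n f f₊≈0) (f₊≈0 n)) (+-identityʳ _)

  Σ≤-reverse : ∀ n f → Σ≤ n f ≈ Σ≤ n (λ i → f (n ∸ i))
  Σ≤-reverse zero    f = refl
  Σ≤-reverse (suc n) f = begin
    Σ≤ n f + f (suc n)                     ≈⟨ +-congʳ (Σ≤-reverse n f) ⟩
    Σ≤ n (λ i → f (n ∸ i)) + f (suc n)     ≈⟨ +-comm _ _ ⟩
    f (suc n) + Σ≤ n (λ i → f (n ∸ i))     ≈⟨ Σ≤-suc n (λ i → f (suc n ∸ i)) ⟨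
    Σ≤ (suc n) (λ i → f (suc n ∸ i))       ∎

  Σ≤-triangle : ∀ n (F : ℕ → ℕ → Carrier) →
    Σ≤ n (λ i → Σ≤ (n ∸ i) (F i)) ≈ Σ≤ n (λ k → Σ≤ k (λ i → F i (k ∸ i)))
  Σ≤-triangle zero    F = refl
  Σ≤-triangle (suc n) F = begin
    Σ≤ (suc n) (λ i → Σ≤ (suc n ∸ i) (F i))
      ≈⟨ Σ≤-suc n _ ⟩
    Σ≤ (suc n) (F 0) + Σ≤ n (λ i → Σ≤ (n ∸ i) (F (suc i)))
      ≈⟨ +-cong (Σ≤-suc n (F 0)) (Σ≤-triangle n (F ∘ suc)) ⟩
    (F 0 0 + Σ≤ n (F 0 ∘ suc)) + Σ≤ n (λ k → Σ≤ k (λ i → F (suc i) (k ∸ i)))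
      ≈⟨ +-assoc _ _ _ ⟩
    F 0 0 + (Σ≤ n (F 0 ∘ suc) + Σ≤ n (λ k → Σ≤ k (λ i → F (suc i) (k ∸ i))))
      ≈⟨ +-congˡ (Σ≤-distrib-+ n _ _) ⟨
    F 0 0 + Σ≤ n (λ k → F 0 (suc k) + Σ≤ k (λ i → F (suc i) (k ∸ i)))
      ≈⟨ +-congˡ (Σ≤-cong n (λ k → Σ≤-suc k (λ i → F i (suc k ∸ i)))) ⟨
    F 0 0 + Σ≤ n (λ k → Σ≤ (suc k) (λ i → F i (suc k ∸ i)))
      ≈⟨ Σ≤-suc n (λ k → Σ≤ k (λ i → F i (k ∸ i))) ⟨
    Σ≤ (suc n) (λ k → Σ≤ k (λ i → F i (k ∸ i)))
      ∎

  ⊛-cong : ∀ {f f′ g g′} → f ≋ f′ → g ≋ g′ → f ⊛ g ≋ f′ ⊛ g′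
  ⊛-cong f≋f′ g≋g′ n = Σ≤-cong n (λ i → *-cong (f≋f′ i) (g≋g′ (n ∸ i)))

  ⊛-congˡ : ∀ f {g g′} → g ≋ g′ → f ⊛ g ≋ f ⊛ g′
  ⊛-congˡ f = ⊛-cong {f} {f} (λ _ → refl)

  ⊛-congʳ : ∀ g {f f′} → f ≋ f′ → f ⊛ g ≋ f′ ⊛ g
  ⊛-congʳ g f≋f′ = ⊛-cong {g = g} {g′ = g} f≋f′ (λ _ → refl)

  ⊛-comm : ∀ f g → f ⊛ g ≋ g ⊛ f
  ⊛-comm f g n = begin
    Σ≤ n (λ i → f i * g (n ∸ i))                  ≈⟨ Σ≤-reverse n _ ⟩
    Σ≤ n (λ i → f (n ∸ i) * g (n ∸ (n ∸ i)))      ≈⟨ Σ≤-congᵇ n reindex ⟩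
    Σ≤ n (λ i → g i * f (n ∸ i))                  ∎
    where
    reindex : ∀ i → i ≤ n → f (n ∸ i) * g (n ∸ (n ∸ i)) ≈ g i * f (n ∸ i)
    reindex i i≤n = trans (*-comm _ _) (*-congʳ (reflexive (≡.cong g (ℕₚ.m∸[m∸n]≡n i≤n))))

  ⊛-assoc : ∀ f g h → (f ⊛ g) ⊛ h ≋ f ⊛ (g ⊛ h)
  ⊛-assoc f g h n = begin
    Σ≤ n (λ k → Σ≤ k (λ i → f i * g (k ∸ i)) * h (n ∸ k))
      ≈⟨ Σ≤-cong n (λ k → *-distribʳ-Σ≤ k _ _) ⟩
    Σ≤ n (λ k → Σ≤ k (λ i → f i * g (k ∸ i) * h (n ∸ k)))
      ≈⟨ Σ≤-congᵇ n (λ k _ → Σ≤-congᵇ k (λ i i≤k → *-congˡ (reflexive (≡.cong h (∸-∸ i≤k))))) ⟨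
    Σ≤ n (λ k → Σ≤ k (λ i → f i * g (k ∸ i) * h (n ∸ i ∸ (k ∸ i))))
      ≈⟨ Σ≤-triangle n (λ i j → f i * g j * h (n ∸ i ∸ j)) ⟨
    Σ≤ n (λ i → Σ≤ (n ∸ i) (λ j → f i * g j * h (n ∸ i ∸ j)))
      ≈⟨ Σ≤-cong n (λ i → Σ≤-cong (n ∸ i) (λ j → *-assoc _ _ _)) ⟩
    Σ≤ n (λ i → Σ≤ (n ∸ i) (λ j → f i * (g j * h (n ∸ i ∸ j))))
      ≈⟨ Σ≤-cong n (λ i → *-distribˡ-Σ≤ (n ∸ i) _ _) ⟨
    Σ≤ n (λ i → f i * Σ≤ (n ∸ i) (λ j → g j * h (n ∸ i ∸ j)))
      ∎
    where
    ∸-∸ : ∀ {i k} → i ≤ k → n ∸ i ∸ (k ∸ i) ≡ n ∸ k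
    ∸-∸ {i} {k} i≤k = ≡.trans (ℕₚ.∸-+-assoc n i (k ∸ i)) (≡.cong (n ∸_) (ℕₚ.m+[n∸m]≡n i≤k))

  constant-⊛ : ∀ x f n → (constant x ⊛ f) n ≈ x * f n
  constant-⊛ x f n = Σ≤-head n (λ i → constant x i * f (n ∸ i)) (λ i → zeroˡ _)

  ⊛-identityˡ : ∀ f → 𝟙 ⊛ f ≋ f
  ⊛-identityˡ f n = trans (constant-⊛ 1# f n) (*-identityˡ _)

  ⊛-distribʳ : ∀ f g h → (g ⊕ h) ⊛ f ≋ g ⊛ f ⊕ h ⊛ f
  ⊛-distribʳ f g h n = trans (Σ≤-cong n (λ i → distribʳ _ _ _)) (Σ≤-distrib-+ n _ _)

  commutativeRing : CommutativeRing c ℓ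
  commutativeRing = record
    { isCommutativeRing = record
      { isRing = record
        { +-isAbelianGroup = record
          { isGroup = record
            { isMonoid = record
              { isSemigroup = record
                { isMagma = record
                  { isEquivalence = record
                    { refl  = λ _ → refl
                    ; sym   = λ f≋g n → sym (f≋g n)
                    ; trans = λ f≋g g≋h n → trans (f≋g n) (g≋h n)
                    }
                  ; ∙-cong = λ f≋f′ g≋g′ n → +-cong (f≋f′ n) (g≋g′ n)
                  }
                ; assoc = λ f g h n → +-assoc _ _ _
                }
              ; identity = (λ f n → +-identityˡ _) , (λ f n → +-identityʳ _)
              }
            ; inverse = (λ f n → -‿inverseˡ _) , (λ f n → -‿inverseʳ _)
            ; ⁻¹-cong = λ f≋g n → -‿cong (f≋g n)
            }
          ; comm = λ f g n → +-comm _ _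
          }
        ; *-cong     = ⊛-cong
        ; *-assoc    = ⊛-assoc
        ; *-identity = ⊛-identityˡ , (λ f n → trans (⊛-comm f 𝟙 n) (⊛-identityˡ f n))
        ; distrib    = (λ f g h n → trans (⊛-comm f (g ⊕ h) n)
                                    (trans (⊛-distribʳ f g h n)
                                    (+-cong (⊛-comm g f n) (⊛-comm h f n))))
                     , ⊛-distribʳ
        }
      ; *-comm = ⊛-comm
      }
    }

  constant-cong : ∀ {x y} → x ≈ y → constant x ≋ constant y
  constant-cong x≈y zero    = x≈y
  constant-cong x≈y (suc _) = refl

  constant-*-homo : ∀ x y → constant (x * y) ≋ constant x ⊛ constant y
  constant-*-homo x y zero    = sym (constant-⊛ x (constant y) zero)
  constant-*-homo x y (suc n) = sym (trans (constant-⊛ x (constant y) (suc n)) (zeroʳ x))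

  constant-‿homo : ∀ x → constant (- x) ≋ ⊝ constant x
  constant-‿homo x zero    = refl
  constant-‿homo x (suc _) = sym -0#≈0#

module ShuffleRelations {c ℓ} (R : CommutativeRing c ℓ) where
  open CommutativeRing R
  open SetoidReasoning setoid
  open NaturalSolver commutativeSemiring using (solve; _:*_; _:=_)

  x+[y-x]≈y : ∀ x y → x + (y + - x) ≈ y
  x+[y-x]≈y x y = begin
    x + (y + - x)  ≈⟨ +-congˡ (+-comm y (- x)) ⟩
    x + (- x + y)  ≈⟨ +-assoc x (- x) y ⟨
    x + - x + y    ≈⟨ +-congʳ (-‿inverseʳ x) ⟩
    0# + y         ≈⟨ +-identityˡ y ⟩
    y              ∎

  x+[y-y]≈x : ∀ x y → x + (y + - y) ≈ x
  x+[y-y]≈x x y = trans (+-congˡ (-‿inverseʳ y)) (+-identityʳ x)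

  module _ (A : Carrier → Carrier) (A-cong : ∀ {x y} → x ≈ y → A x ≈ A y) (z : Carrier) where

    shuffle-ab : ∀ x y → A x * (z * y) ≈ A (x * (z * y)) + (z * (A x * y) + - A (z * (x * y)))
    shuffle-ab x y = sym (begin
      A (x * (z * y)) + (z * (A x * y) + - A (z * (x * y)))
        ≈⟨ +-congʳ (A-cong (solve 3 (λ x y z → x :* (z :* y) := z :* (x :* y)) refl x y z)) ⟩
      A (z * (x * y)) + (z * (A x * y) + - A (z * (x * y)))
        ≈⟨ x+[y-x]≈y _ _ ⟩
      z * (A x * y)
        ≈⟨ solve 3 (λ ax y z → z :* (ax :* y) := ax :* (z :* y)) refl (A x) y z ⟩
      A x * (z * y)
        ∎)

    shuffle-ba : ∀ x y → z * x * A y ≈ z * (x * A y) + (A (z * x * y) + - A (z * (x * y)))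
    shuffle-ba x y = sym (begin
      z * (x * A y) + (A (z * x * y) + - A (z * (x * y)))  ≈⟨ +-congˡ (+-congʳ (A-cong (*-assoc z x y))) ⟩
      z * (x * A y) + (A (z * (x * y)) + - A (z * (x * y)))  ≈⟨ x+[y-y]≈x _ _ ⟩
      z * (x * A y)                                          ≈⟨ *-assoc z x (A y) ⟨
      z * x * A y                                            ∎)

  shuffle-bb : ∀ z x y → z * x * (z * y) ≈ z * (x * (z * y)) + (z * (z * x * y) + - (z * (z * (x * y))))
  shuffle-bb z x y = sym (begin
    z * (x * (z * y)) + (z * (z * x * y) + - (z * (z * (x * y))))
      ≈⟨ +-congˡ (+-congʳ (*-congˡ (*-assoc z x y))) ⟩
    z * (x * (z * y)) + (z * (z * (x * y)) + - (z * (z * (x * y))))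
      ≈⟨ x+[y-y]≈x _ _ ⟩
    z * (x * (z * y))
      ≈⟨ *-assoc z x (z * y) ⟨
    z * x * (z * y)
      ∎)

ℚ[[q]] : CommutativeRing _ _
ℚ[[q]] = PowerSeries.commutativeRing ℚₚ.+-*-commutativeRing

module Qq = CommutativeRing ℚ[[q]]
module Qq-Solver = NaturalSolver Qq.commutativeSemiring
open PowerSeries ℚₚ.+-*-commutativeRing
  using (Series; _≋_; Σ≤; _⊕_; _⊛_; ⊝_; 𝟘; 𝟙; constant;
         Σ≤-cong; Σ≤-suc; ⊛-congˡ; ⊛-congʳ; constant-⊛; constant-*-homo; constant-‿homo)
open SemiringExp Qq.semiring using (_^_; ^-homo-*)
open CommutativeSemiringExp Qq.commutativeSemiring using (^-distrib-*)

sumTo≡Σ≤ : ∀ n f → sumTo n f ≡ Σ≤ n f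
sumTo≡Σ≤ zero    f = ≡.refl
sumTo≡Σ≤ (suc n) f = ≡.cong (ℚ._+ f (suc n)) (sumTo≡Σ≤ n f)

*S≋⊛ : ∀ f g → f *S g ≋ f ⊛ g
*S≋⊛ f g n = sumTo≡Σ≤ n _

oneS≋𝟙 : oneS ≋ 𝟙
oneS≋𝟙 zero    = ≡.refl
oneS≋𝟙 (suc _) = ≡.refl

powS≋^ : ∀ f k → powS f k ≋ f ^ k
powS≋^ f zero    = oneS≋𝟙
powS≋^ f (suc k) = Qq.trans (*S≋⊛ f (powS f k)) (⊛-congˡ f (powS≋^ f k))

scaleS≋constant⊛ : ∀ c f → scaleS c f ≋ constant c ⊛ f
scaleS≋constant⊛ c f n = ≡.sym (constant-⊛ c f n)

invList-convolution : ∀ f n (φ : ℕ → ℚ) (ψ : ℕ → ℕ) →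
  foldr ℚ._+_ 0ℚ (zipWith ℚ._*_ (map φ (applyUpTo ψ (suc n))) (invList f n))
    ≡ Σ≤ n (λ k → φ (ψ k) ℚ.* invS f (n ∸ k))
invList-convolution f zero    φ ψ = ℚₚ.+-identityʳ _
invList-convolution f (suc n) φ ψ =
  ≡.trans (≡.cong (φ (ψ 0) ℚ.* invS f (suc n) ℚ.+_) (invList-convolution f n φ (ψ ∘ suc)))
          (≡.sym (Σ≤-suc n (λ k → φ (ψ k) ℚ.* invS f (suc n ∸ k))))

invS-suc : ∀ f n → invS f (suc n) ≡ ℚ.- Σ≤ n (λ k → f (suc k) ℚ.* invS f (n ∸ k))
invS-suc f n = ≡.cong ℚ.-_ (invList-convolution f n (f ∘ suc) (λ k → k))

invS-inverseʳ : ∀ f → f 0 ≡ 1ℚ → f ⊛ invS f ≋ 𝟙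
invS-inverseʳ f f₀≡1 zero    = ≡.cong (ℚ._* 1ℚ) f₀≡1
invS-inverseʳ f f₀≡1 (suc n) = begin
  Σ≤ (suc n) (λ i → f i ℚ.* invS f (suc n ∸ i))   ≡⟨ Σ≤-suc n _ ⟩
  f 0 ℚ.* invS f (suc n) ℚ.+ S                     ≡⟨ ≡.cong (ℚ._+ S) (≡.cong₂ ℚ._*_ f₀≡1 (invS-suc f n)) ⟩
  1ℚ ℚ.* (ℚ.- S) ℚ.+ S                             ≡⟨ ≡.cong (ℚ._+ S) (ℚₚ.*-identityˡ (ℚ.- S)) ⟩
  ℚ.- S ℚ.+ S                                      ≡⟨ ℚₚ.+-inverseˡ S ⟩
  0ℚ                                               ∎
  where
  open ≡.≡-Reasoning
  S = Σ≤ n (λ k → f (suc k) ℚ.* invS f (n ∸ k))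

q : Series
q = qmono 1

q⊛-zero : ∀ f → (q ⊛ f) 0 ≡ 0ℚ
q⊛-zero f = ℚₚ.*-zeroˡ (f 0)

q⊛-suc : ∀ f n → (q ⊛ f) (suc n) ≡ f n
q⊛-suc f n = begin
  Σ≤ (suc n) (λ i → q i ℚ.* f (suc n ∸ i))   ≡⟨ Σ≤-suc n _ ⟩
  0ℚ ℚ.* f (suc n) ℚ.+ (oneS ⊛ f) n          ≡⟨ ≡.cong₂ ℚ._+_ (ℚₚ.*-zeroˡ (f (suc n))) (⊛-congʳ f oneS≋𝟙 n) ⟩
  0ℚ ℚ.+ (𝟙 ⊛ f) n                           ≡⟨ ℚₚ.+-identityˡ _ ⟩
  (𝟙 ⊛ f) n                                  ≡⟨ Qq.*-identityˡ f n ⟩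
  f n                                        ∎
  where open ≡.≡-Reasoning

qmono-suc : ∀ m → qmono (suc m) ≋ q ⊛ qmono m
qmono-suc m zero    = ≡.sym (q⊛-zero (qmono m))
qmono-suc m (suc n) = ≡.sym (q⊛-suc (qmono m) n)

qmono-+ : ∀ m n → qmono (m ℕ.+ n) ≋ qmono m ⊛ qmono n
qmono-+ zero    n = Qq.sym (Qq.trans (⊛-congʳ (qmono n) oneS≋𝟙) (Qq.*-identityˡ (qmono n)))
qmono-+ (suc m) n = begin
  qmono (suc (m ℕ.+ n))      ≈⟨ qmono-suc (m ℕ.+ n) ⟩
  q ⊛ qmono (m ℕ.+ n)        ≈⟨ ⊛-congˡ q (qmono-+ m n) ⟩
  q ⊛ (qmono m ⊛ qmono n)    ≈⟨ Qq.*-assoc q (qmono m) (qmono n) ⟨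
  q ⊛ qmono m ⊛ qmono n      ≈⟨ ⊛-congʳ (qmono n) (qmono-suc m) ⟨
  qmono (suc m) ⊛ qmono n    ∎
  where open SetoidReasoning Qq.setoid

qmono-*≋^ : ∀ k m → qmono (k ℕ.* m) ≋ qmono m ^ k
qmono-*≋^ zero    m = oneS≋𝟙
qmono-*≋^ (suc k) m = Qq.trans (qmono-+ m (k ℕ.* m)) (⊛-congˡ (qmono m) (qmono-*≋^ k m))

qint-suc : ∀ m → qint (suc m) ≋ 𝟙 ⊕ q ⊛ qint m
qint-suc m zero    = ≡.sym (≡.trans (≡.cong (1ℚ ℚ.+_) (q⊛-zero (qint m))) (ℚₚ.+-identityʳ 1ℚ))
qint-suc m (suc n) = ≡.sym (≡.trans (ℚₚ.+-identityˡ _) (q⊛-suc (qint m) n))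

qint-+ : ∀ i j → qint (i ℕ.+ j) ≋ qint i ⊕ qmono i ⊛ qint j
qint-+ zero    j =
  Qq.sym (Qq.trans (Qq.+-identityˡ (qmono 0 ⊛ qint j)) (Qq.trans (⊛-congʳ (qint j) oneS≋𝟙) (Qq.*-identityˡ (qint j))))
qint-+ (suc i) j = begin
  qint (suc (i ℕ.+ j))                        ≈⟨ qint-suc (i ℕ.+ j) ⟩
  𝟙 ⊕ q ⊛ qint (i ℕ.+ j)                      ≈⟨ Qq.+-congˡ {𝟙} (⊛-congˡ q (qint-+ i j)) ⟩
  𝟙 ⊕ q ⊛ (qint i ⊕ qmono i ⊛ qint j)         ≈⟨ solve 4 (λ o x u v → o :+ x :* (u :+ v) := (o :+ x :* u) :+ x :* v)
                                                    Qq.refl 𝟙 q (qint i) (qmono i ⊛ qint j) ⟩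
  (𝟙 ⊕ q ⊛ qint i) ⊕ q ⊛ (qmono i ⊛ qint j)   ≈⟨ Qq.+-cong (qint-suc i) (Qq.*-assoc q (qmono i) (qint j)) ⟨
  qint (suc i) ⊕ q ⊛ qmono i ⊛ qint j         ≈⟨ Qq.+-congˡ {qint (suc i)} (⊛-congʳ (qint j) (qmono-suc i)) ⟨
  qint (suc i) ⊕ qmono (suc i) ⊛ qint j       ∎
  where open SetoidReasoning Qq.setoid
        open Qq-Solver using (solve; _:+_; _:*_; _:=_)

ħ : Series
ħ = oneMinusQ

ħ⊕q≋𝟙 : ħ ⊕ q ≋ 𝟙
ħ⊕q≋𝟙 zero          = ℚₚ.+-identityʳ 1ℚ
ħ⊕q≋𝟙 (suc zero)    = ℚₚ.+-inverseˡ 1ℚ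
ħ⊕q≋𝟙 (suc (suc _)) = ≡.refl

ħ⊛qint⊕qmono≋𝟙 : ∀ j → ħ ⊛ qint j ⊕ qmono j ≋ 𝟙
ħ⊛qint⊕qmono≋𝟙 zero    = Qq.trans (Qq.+-cong {ħ ⊛ qint 0} {𝟘} (Qq.zeroʳ ħ) oneS≋𝟙) (Qq.+-identityˡ 𝟙)
ħ⊛qint⊕qmono≋𝟙 (suc j) = begin
  ħ ⊛ qint (suc j) ⊕ qmono (suc j)      ≈⟨ Qq.+-cong (⊛-congˡ ħ (qint-suc j)) (qmono-suc j) ⟩
  ħ ⊛ (𝟙 ⊕ q ⊛ qint j) ⊕ q ⊛ qmono j    ≈⟨ solve 5 (λ h o x u v → h :* (o :+ x :* u) :+ x :* v := h :* o :+ x :* (h :* u :+ v))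
                                              Qq.refl ħ 𝟙 q (qint j) (qmono j) ⟩
  ħ ⊛ 𝟙 ⊕ q ⊛ (ħ ⊛ qint j ⊕ qmono j)    ≈⟨ Qq.+-cong (Qq.*-identityʳ ħ)
                                              (Qq.trans (⊛-congˡ q (ħ⊛qint⊕qmono≋𝟙 j)) (Qq.*-identityʳ q)) ⟩
  ħ ⊕ q                                 ≈⟨ ħ⊕q≋𝟙 ⟩
  𝟙                                     ∎
  where open SetoidReasoning Qq.setoid
        open Qq-Solver using (solve; _:+_; _:*_; _:=_)

qint-inverse : ∀ m → qint (suc m) ⊛ invS (qint (suc m)) ≋ 𝟙
qint-inverse m = invS-inverseʳ (qint (suc m)) ≡.refl

-- q^m / [m]_q; for m = 0 this is junk, as [0]_q = 0 is not invertible.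
qfrac : ℕ → Series
qfrac m = qmono m ⊛ invS (qint m)

qfrac-product : ∀ i j →
  qfrac (suc i) ⊛ qfrac (suc j) ≋ qfrac (suc i ℕ.+ suc j) ⊛ (qfrac (suc j) ⊕ qfrac (suc i) ⊕ ħ)
qfrac-product i j = Qq.sym (begin
  qfrac N ⊛ (Qj ⊛ Dj ⊕ Qi ⊛ Di ⊕ ħ)     ≈⟨ Qq.*-cong (⊛-congʳ DN (qmono-+ (suc i) (suc j))) sum-of-fractions ⟩
  Qi ⊛ Qj ⊛ DN ⊛ (Di ⊛ Dj ⊛ IN)         ≈⟨ solve 6 (λ qi qj dn di dj iN → qi :* qj :* dn :* (di :* dj :* iN)
                                                                     := qi :* di :* (qj :* dj) :* (iN :* dn))
                                             Qq.refl Qi Qj DN Di Dj IN ⟩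
  Qi ⊛ Di ⊛ (Qj ⊛ Dj) ⊛ (IN ⊛ DN)       ≈⟨ ⊛-congˡ (Qi ⊛ Di ⊛ (Qj ⊛ Dj)) (qint-inverse (i ℕ.+ suc j)) ⟩
  Qi ⊛ Di ⊛ (Qj ⊛ Dj) ⊛ 𝟙               ≈⟨ Qq.*-identityʳ _ ⟩
  Qi ⊛ Di ⊛ (Qj ⊛ Dj)                   ∎)
  where
  open SetoidReasoning Qq.setoid
  open Qq-Solver using (solve; _:+_; _:*_; _:=_)
  N = suc i ℕ.+ suc j
  Qi = qmono (suc i)
  Qj = qmono (suc j)
  Ii = qint (suc i)
  Ij = qint (suc j)
  IN = qint N
  Di = invS Ii
  Dj = invS Ij
  DN = invS IN

  ⊛-inverse-intro : ∀ m x → x ≋ x ⊛ (qint (suc m) ⊛ invS (qint (suc m)))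
  ⊛-inverse-intro m x = Qq.sym (Qq.trans (⊛-congˡ x (qint-inverse m)) (Qq.*-identityʳ x))

  sum-of-fractions : Qj ⊛ Dj ⊕ Qi ⊛ Di ⊕ ħ ≋ Di ⊛ Dj ⊛ IN
  sum-of-fractions = begin
    Qj ⊛ Dj ⊕ Qi ⊛ Di ⊕ ħ
      ≈⟨ Qq.+-cong (Qq.+-cong (⊛-inverse-intro i (Qj ⊛ Dj)) (⊛-inverse-intro j (Qi ⊛ Di)))
                   (Qq.trans (⊛-inverse-intro i ħ) (⊛-inverse-intro j (ħ ⊛ (Ii ⊛ Di)))) ⟩
    Qj ⊛ Dj ⊛ (Ii ⊛ Di) ⊕ Qi ⊛ Di ⊛ (Ij ⊛ Dj) ⊕ ħ ⊛ (Ii ⊛ Di) ⊛ (Ij ⊛ Dj)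
      ≈⟨ solve 7 (λ qi qj ii ij di dj h →
                   qj :* dj :* (ii :* di) :+ qi :* di :* (ij :* dj) :+ h :* (ii :* di) :* (ij :* dj)
                := di :* dj :* (ii :* (h :* ij :+ qj) :+ qi :* ij))
                 Qq.refl Qi Qj Ii Ij Di Dj ħ ⟩
    Di ⊛ Dj ⊛ (Ii ⊛ (ħ ⊛ Ij ⊕ Qj) ⊕ Qi ⊛ Ij)
      ≈⟨ ⊛-congˡ (Di ⊛ Dj) (Qq.+-congʳ {Qi ⊛ Ij} (Qq.trans (⊛-congˡ Ii (ħ⊛qint⊕qmono≋𝟙 (suc j))) (Qq.*-identityʳ Ii))) ⟩
    Di ⊛ Dj ⊛ (Ii ⊕ Qi ⊛ Ij)
      ≈⟨ ⊛-congˡ (Di ⊛ Dj) (qint-+ (suc i) (suc j)) ⟨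
    Di ⊛ Dj ⊛ IN
      ∎

factor≋qfrac^ : ∀ k m → factor k m ≋ qfrac m ^ k
factor≋qfrac^ k m =
  Qq.trans (*S≋⊛ (qmono (k ℕ.* m)) (powS (invS (qint m)) k))
  (Qq.trans (Qq.*-cong (qmono-*≋^ k m) (powS≋^ (invS (qint m)) k))
            (Qq.sym (^-distrib-* (qmono m) (invS (qint m)) k)))

ħ⁻¹ : Series
ħ⁻¹ = invS ħ

ħ⊛ħ⁻¹≋𝟙 : ħ ⊛ ħ⁻¹ ≋ 𝟙
ħ⊛ħ⁻¹≋𝟙 = invS-inverseʳ ħ ≡.refl

ħ^ : ℤ → Series
ħ^ (+ n)    = ħ ^ n
ħ^ -[1+ n ] = ħ⁻¹ ^ suc n

hbarPow≋ħ^ : ∀ e → hbarPow e ≋ ħ^ e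
hbarPow≋ħ^ (+ n)    = powS≋^ ħ n
hbarPow≋ħ^ -[1+ n ] = powS≋^ ħ⁻¹ (suc n)

ħ^-⊖ : ∀ m n → ħ^ (m ⊖ n) ≋ ħ ^ m ⊛ ħ⁻¹ ^ n
ħ^-⊖ m       zero    = Qq.sym (Qq.*-identityʳ (ħ ^ m))
ħ^-⊖ zero    (suc n) = Qq.sym (Qq.*-identityˡ (ħ⁻¹ ^ suc n))
ħ^-⊖ (suc m) (suc n) rewrite ℤₚ.[1+m]⊖[1+n]≡m⊖n m n = begin
  ħ^ (m ⊖ n)                          ≈⟨ ħ^-⊖ m n ⟩
  ħ ^ m ⊛ ħ⁻¹ ^ n                     ≈⟨ Qq.*-identityʳ _ ⟨
  ħ ^ m ⊛ ħ⁻¹ ^ n ⊛ 𝟙                 ≈⟨ ⊛-congˡ (ħ ^ m ⊛ ħ⁻¹ ^ n) ħ⊛ħ⁻¹≋𝟙 ⟨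
  ħ ^ m ⊛ ħ⁻¹ ^ n ⊛ (ħ ⊛ ħ⁻¹)         ≈⟨ solve 4 (λ u v h h′ → u :* v :* (h :* h′) := h :* u :* (h′ :* v))
                                           Qq.refl (ħ ^ m) (ħ⁻¹ ^ n) ħ ħ⁻¹ ⟩
  ħ ⊛ ħ ^ m ⊛ (ħ⁻¹ ⊛ ħ⁻¹ ^ n)         ∎
  where open SetoidReasoning Qq.setoid
        open Qq-Solver using (solve; _:*_; _:=_)

ħ^-+ : ∀ e₁ e₂ → ħ^ (e₁ ℤ.+ e₂) ≋ ħ^ e₁ ⊛ ħ^ e₂
ħ^-+ (+ m)     (+ n)     = ^-homo-* ħ m n
ħ^-+ (+ m)     -[1+ n ]  = ħ^-⊖ m (suc n)
ħ^-+ -[1+ m ]  (+ n)     = Qq.trans (ħ^-⊖ n (suc m)) (Qq.*-comm (ħ ^ n) (ħ⁻¹ ^ suc m))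
ħ^-+ -[1+ m ]  -[1+ n ]  = Qq.trans (Qq.reflexive (≡.cong (λ k → ħ⁻¹ ^ suc k) (≡.sym (ℕₚ.+-suc m n))))
                                    (^-homo-* ħ⁻¹ (suc m) (suc n))

scalar : ℤ → ℚ → Series
scalar e c = constant c ⊛ ħ^ e

scalar-*-homo : ∀ e₁ e₂ c₁ c₂ → scalar (e₁ ℤ.+ e₂) (c₁ ℚ.* c₂) ≋ scalar e₁ c₁ ⊛ scalar e₂ c₂
scalar-*-homo e₁ e₂ c₁ c₂ =
  Qq.trans (Qq.*-cong (constant-*-homo c₁ c₂) (ħ^-+ e₁ e₂))
           (solve 4 (λ x y u v → x :* y :* (u :* v) := x :* u :* (y :* v)) Qq.refl
                  (constant c₁) (constant c₂) (ħ^ e₁) (ħ^ e₂))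
  where open Qq-Solver using (solve; _:*_; _:=_)

scalar-‿homo : ∀ e c → scalar e (ℚ.- c) ≋ ⊝ scalar e c
scalar-‿homo e c = Qq.trans (⊛-congʳ (ħ^ e) (constant-‿homo c)) (Qq.sym (-‿distribˡ-* (constant c) (ħ^ e)))
  where open RingProperties Qq.ring using (-‿distribˡ-*)

scalar-ħ : ∀ e c → scalar (e ℤ.+ + 1) c ≋ ħ ⊛ scalar e c
scalar-ħ e c =
  Qq.trans (⊛-congˡ (constant c) (Qq.trans (ħ^-+ e (+ 1)) (⊛-congˡ (ħ^ e) (Qq.*-identityʳ ħ))))
           (solve 3 (λ x u h → x :* (u :* h) := h :* (x :* u)) Qq.refl (constant c) (ħ^ e) ħ)
  where open Qq-Solver using (solve; _:*_; _:=_)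

scalar-unit : scalar (+ 0) 1ℚ ≋ 𝟙
scalar-unit = Qq.*-identityˡ 𝟙

ℚ[[q,z]] : CommutativeRing _ _
ℚ[[q,z]] = PowerSeries.commutativeRing ℚ[[q]]

module Qqz = CommutativeRing ℚ[[q,z]]
module Qqz-Solver = NaturalSolver Qqz.commutativeSemiring
open PowerSeries ℚ[[q]] using ()
  renaming (_≋_ to _≋ᴾ_; _⊕_ to _⊕ᴾ_; _⊛_ to _⊛ᴾ_; ⊝_ to ⊝ᴾ_; 𝟘 to 𝟘ᴾ; 𝟙 to 𝟙ᴾ; Σ≤ to Σᴾ≤;
            constant to constᴾ; constant-⊛ to constᴾ-⊛; constant-cong to constᴾ-cong;
            constant-*-homo to constᴾ-*-homo; constant-‿homo to constᴾ-‿homo;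
            ⊛-congˡ to ⊛ᴾ-congˡ; ⊛-congʳ to ⊛ᴾ-congʳ; Σ≤-suc to Σᴾ≤-suc; Σ≤-cong to Σᴾ≤-cong;
            Σ≤-reverse to Σᴾ≤-reverse; Σ≤-distrib-+ to Σᴾ≤-distrib-+; *-distribˡ-Σ≤ to *-distribˡ-Σᴾ≤;
            Σ≤-congᵇ to Σᴾ≤-congᵇ; Σ≤-head to Σᴾ≤-head)
open ShuffleRelations ℚ[[q,z]] using (shuffle-ab; shuffle-ba; shuffle-bb)
open RingProperties Qqz.ring using (-0#≈0#; -‿+-comm; -‿distribˡ-*)
open MonoidMorphisms Qqz.+-rawMonoid Qqz.+-rawMonoid using (IsMonoidHomomorphism)
open IsMonoidHomomorphism using (⟦⟧-cong; homo; ε-homo)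

Σᴾ≤-coeff : ∀ N (h : ℕ → Series) n → Σᴾ≤ N h n ≡ Σ≤ N (λ j → h j n)
Σᴾ≤-coeff zero    h n = ≡.refl
Σᴾ≤-coeff (suc N) h n = ≡.cong (ℚ._+ h (suc N) n) (Σᴾ≤-coeff N h n)

*P≋⊛ᴾ : ∀ F G → F *P G ≋ᴾ F ⊛ᴾ G
*P≋⊛ᴾ F G N n =
  ≡.trans (sumTo≡Σ≤ N _)
  (≡.trans (Σ≤-cong N (λ j → *S≋⊛ (F j) (G (N ∸ j)) n))
           (≡.sym (Σᴾ≤-coeff N (λ j → F j ⊛ G (N ∸ j)) n)))

actP≋constᴾ⊛ᴾ : ∀ e c F → actP e c F ≋ᴾ constᴾ (scalar e c) ⊛ᴾ F
actP≋constᴾ⊛ᴾ e c F N = begin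
  scaleS c (hbarPow e *S F N)     ≈⟨ scaleS≋constant⊛ c _ ⟩
  constant c ⊛ (hbarPow e *S F N) ≈⟨ ⊛-congˡ (constant c) (Qq.trans (*S≋⊛ (hbarPow e) (F N)) (⊛-congʳ (F N) (hbarPow≋ħ^ e))) ⟩
  constant c ⊛ (ħ^ e ⊛ F N)       ≈⟨ Qq.*-assoc (constant c) (ħ^ e) (F N) ⟨
  scalar e c ⊛ F N                ≈⟨ constᴾ-⊛ (scalar e c) F N ⟨
  (constᴾ (scalar e c) ⊛ᴾ F) N    ∎
  where open SetoidReasoning Qq.setoid

term : {W : Set} → (W → PS) → ℤ × ℚ × W → PS
term L (e , c , w) = constᴾ (scalar e c) ⊛ᴾ L w

eval : {W : Set} → (W → PS) → Lin W → PS
eval L = foldr (λ t F → term L t ⊕ᴾ F) 𝟘ᴾ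

LiLin≋eval : ∀ {W : Set} (L : W → PS) X → LiLin L X ≋ᴾ eval L X
LiLin≋eval L []              = Qqz.refl
LiLin≋eval L ((e , c , w) ∷ X) = Qqz.+-cong (actP≋constᴾ⊛ᴾ e c (L w)) (LiLin≋eval L X)

eval-cong : ∀ {W : Set} {L L′ : W → PS} → (∀ w → L w ≋ᴾ L′ w) → ∀ X → eval L X ≋ᴾ eval L′ X
eval-cong L≋L′ []              = Qqz.refl
eval-cong L≋L′ ((e , c , w) ∷ X) = Qqz.+-cong (⊛ᴾ-congˡ (constᴾ (scalar e c)) (L≋L′ w)) (eval-cong L≋L′ X)

eval-++ : ∀ {W : Set} (L : W → PS) X Y → eval L (X ++ Y) ≋ᴾ eval L X ⊕ᴾ eval L Y
eval-++ L []      Y = Qqz.sym (Qqz.+-identityˡ (eval L Y))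
eval-++ L (t ∷ X) Y = Qqz.trans (Qqz.+-congˡ {term L t} (eval-++ L X Y)) (Qqz.sym (Qqz.+-assoc (term L t) (eval L X) (eval L Y)))

eval-single : ∀ {W : Set} (L : W → PS) w → eval L ((+ 0 , 1ℚ , w) ∷ []) ≋ᴾ L w
eval-single L w =
  Qqz.trans (Qqz.+-identityʳ _) (Qqz.trans (⊛ᴾ-congʳ (L w) (constᴾ-cong scalar-unit)) (Qqz.*-identityˡ (L w)))

Additive : (PS → PS) → Set
Additive = IsMonoidHomomorphism

mkAdditive : ∀ {φ} → (∀ {F G} → F ≋ᴾ G → φ F ≋ᴾ φ G) →
  (∀ F G → φ (F ⊕ᴾ G) ≋ᴾ φ F ⊕ᴾ φ G) → φ 𝟘ᴾ ≋ᴾ 𝟘ᴾ → Additive φ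
mkAdditive φ-cong φ-homo φ-𝟘 = record
  { isMagmaHomomorphism = record { isRelHomomorphism = record { cong = φ-cong } ; homo = φ-homo }
  ; ε-homo = φ-𝟘
  }

∘-additive : ∀ {φ ψ} → Additive φ → Additive ψ → Additive (ψ ∘ φ)
∘-additive = Composition.isMonoidHomomorphism Qqz.trans

⊛ᴾ-additiveˡ : ∀ S → Additive (S ⊛ᴾ_)
⊛ᴾ-additiveˡ S = mkAdditive (⊛ᴾ-congˡ S) (Qqz.distribˡ S) (Qqz.zeroʳ S)

⊛ᴾ-additiveʳ : ∀ S → Additive (_⊛ᴾ S)
⊛ᴾ-additiveʳ S = mkAdditive (⊛ᴾ-congʳ S) (λ F G → Qqz.distribʳ S F G) (Qqz.zeroˡ S)

⊝ᴾ-additive : Additive ⊝ᴾ_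
⊝ᴾ-additive = mkAdditive Qqz.-‿cong (λ F G → Qqz.sym (-‿+-comm F G)) -0#≈0#

eval-map : ∀ {V W : Set} {L : V → PS} {L′ : W → PS} {φ} → Additive φ →
  (H : ℤ × ℚ × V → ℤ × ℚ × W) → (∀ t → term L′ (H t) ≋ᴾ φ (term L t)) →
  ∀ X → eval L′ (map H X) ≋ᴾ φ (eval L X)
eval-map φ-add H H-term []      = Qqz.sym (ε-homo φ-add)
eval-map {L = L} {L′} φ-add H H-term (t ∷ X) =
  Qqz.trans (Qqz.+-cong (H-term t) (eval-map {L = L} {L′} φ-add H H-term X)) (Qqz.sym (homo φ-add (term L t) (eval L X)))

eval-concatMap : ∀ {V W : Set} {L : V → PS} {L′ : W → PS} {φ} → Additive φ →
  (G : ℤ × ℚ × V → Lin W) → (∀ t → eval L′ (G t) ≋ᴾ φ (term L t)) →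
  ∀ X → eval L′ (concatMap G X) ≋ᴾ φ (eval L X)
eval-concatMap φ-add G G-term []      = Qqz.sym (ε-homo φ-add)
eval-concatMap {L = L} {L′} φ-add G G-term (t ∷ X) =
  Qqz.trans (eval-++ L′ (G t) (concatMap G X))
  (Qqz.trans (Qqz.+-cong (G-term t) (eval-concatMap {L = L} {L′} φ-add G G-term X)) (Qqz.sym (homo φ-add (term L t) (eval L X))))

eval-negL : ∀ (L : ABWord → PS) X → eval L (negL X) ≋ᴾ ⊝ᴾ eval L X
eval-negL L = eval-map {L = L} {L} ⊝ᴾ-additive _ λ (e , c , w) →
  Qqz.trans (⊛ᴾ-congʳ (L w) (Qqz.trans (constᴾ-cong (scalar-‿homo e c)) (constᴾ-‿homo (scalar e c))))
            (Qqz.sym (-‿distribˡ-* (constᴾ (scalar e c)) (L w)))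

eval-hbarL : ∀ (L : ABWord → PS) X → eval L (hbarL X) ≋ᴾ constᴾ ħ ⊛ᴾ eval L X
eval-hbarL L = eval-map {L = L} {L} (⊛ᴾ-additiveˡ (constᴾ ħ)) _ λ (e , c , w) →
  Qqz.trans (⊛ᴾ-congʳ (L w) (Qqz.trans (constᴾ-cong (scalar-ħ e c)) (constᴾ-*-homo ħ (scalar e c))))
            (Qqz.*-assoc (constᴾ ħ) (constᴾ (scalar e c)) (L w))

aOp : PS → PS
aOp F zero    = 𝟘
aOp F (suc N) = qfrac (suc N) ⊛ F (suc N)

z/[1-z] : PS
z/[1-z] zero    = 𝟘
z/[1-z] (suc _) = 𝟙

letterOp : Letter → PS → PS
letterOp a F = aOp F
letterOp b F = z/[1-z] ⊛ᴾ F

wordOp : ABWord → PS → PS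
wordOp []      F = F
wordOp (α ∷ u) F = letterOp α (wordOp u F)

LiOp : ABWord → PS
LiOp u = wordOp u 𝟙ᴾ

aOp-additive : Additive aOp
aOp-additive = mkAdditive aOp-cong aOp-homo aOp-𝟘
  where
  aOp-cong : ∀ {F G} → F ≋ᴾ G → aOp F ≋ᴾ aOp G
  aOp-cong F≋G zero    = Qq.refl
  aOp-cong F≋G (suc N) = ⊛-congˡ (qfrac (suc N)) (F≋G (suc N))

  aOp-homo : ∀ F G → aOp (F ⊕ᴾ G) ≋ᴾ aOp F ⊕ᴾ aOp G
  aOp-homo F G zero    = Qq.sym (Qq.+-identityˡ 𝟘)
  aOp-homo F G (suc N) = Qq.distribˡ (qfrac (suc N)) (F (suc N)) (G (suc N))

  aOp-𝟘 : aOp 𝟘ᴾ ≋ᴾ 𝟘ᴾ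
  aOp-𝟘 zero    = Qq.refl
  aOp-𝟘 (suc N) = Qq.zeroʳ (qfrac (suc N))

aOp-constᴾ : ∀ S F → aOp (constᴾ S ⊛ᴾ F) ≋ᴾ constᴾ S ⊛ᴾ aOp F
aOp-constᴾ S F zero    = Qq.sym (Qq.trans (constᴾ-⊛ S (aOp F) zero) (Qq.zeroʳ S))
aOp-constᴾ S F (suc N) = begin
  qfrac (suc N) ⊛ (constᴾ S ⊛ᴾ F) (suc N)   ≈⟨ ⊛-congˡ (qfrac (suc N)) (constᴾ-⊛ S F (suc N)) ⟩
  qfrac (suc N) ⊛ (S ⊛ F (suc N))          ≈⟨ solve 3 (λ g s f → g :* (s :* f) := s :* (g :* f)) Qq.refl (qfrac (suc N)) S (F (suc N)) ⟩
  S ⊛ (qfrac (suc N) ⊛ F (suc N))          ≈⟨ constᴾ-⊛ S (aOp F) (suc N) ⟨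
  (constᴾ S ⊛ᴾ aOp F) (suc N)               ∎
  where open SetoidReasoning Qq.setoid
        open Qq-Solver using (solve; _:*_; _:=_)

letterOp-additive : ∀ α → Additive (letterOp α)
letterOp-additive a = aOp-additive
letterOp-additive b = ⊛ᴾ-additiveˡ z/[1-z]

letterOp-constᴾ : ∀ α S F → letterOp α (constᴾ S ⊛ᴾ F) ≋ᴾ constᴾ S ⊛ᴾ letterOp α F
letterOp-constᴾ a S F = aOp-constᴾ S F
letterOp-constᴾ b S F = solve 3 (λ z s f → z :* (s :* f) := s :* (z :* f)) Qqz.refl z/[1-z] (constᴾ S) F
  where open Qqz-Solver using (solve; _:*_; _:=_)

letterOp-zero : ∀ α F → letterOp α F 0 ≋ 𝟘
letterOp-zero a F = Qq.refl
letterOp-zero b F = Qq.zeroˡ (F 0)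

wordOp-additive : ∀ u → Additive (wordOp u)
wordOp-additive []      = Identity.isMonoidHomomorphism Qqz.+-rawMonoid Qqz.refl
wordOp-additive (α ∷ u) = ∘-additive (wordOp-additive u) (letterOp-additive α)

wordOp-constᴾ : ∀ u S F → wordOp u (constᴾ S ⊛ᴾ F) ≋ᴾ constᴾ S ⊛ᴾ wordOp u F
wordOp-constᴾ []      S F = Qqz.refl
wordOp-constᴾ (α ∷ u) S F =
  Qqz.trans (⟦⟧-cong (letterOp-additive α) (wordOp-constᴾ u S F)) (letterOp-constᴾ α S (wordOp u F))

wordOp-++ : ∀ u w F → wordOp (u ++ w) F ≡ wordOp u (wordOp w F)
wordOp-++ []      w F = ≡.refl
wordOp-++ (α ∷ u) w F = ≡.cong (letterOp α) (wordOp-++ u w F)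

eval-prefixL : ∀ u X → eval LiOp (prefixL u X) ≋ᴾ wordOp u (eval LiOp X)
eval-prefixL u = eval-map {L = LiOp} {LiOp} (wordOp-additive u) _ λ (e , c , w) →
  Qqz.trans (⊛ᴾ-congˡ (constᴾ (scalar e c)) (Qqz.reflexive (wordOp-++ u w 𝟙ᴾ)))
            (Qqz.sym (wordOp-constᴾ u (scalar e c) (LiOp w)))

diamondOp : Letter → Letter → PS → PS
diamondOp a a F = aOp (constᴾ ħ ⊛ᴾ F)
diamondOp a b F = ⊝ᴾ wordOp (a ∷ b ∷ []) F
diamondOp b a F = ⊝ᴾ wordOp (a ∷ b ∷ []) F
diamondOp b b F = ⊝ᴾ wordOp (b ∷ b ∷ []) F

diamondOp-additive : ∀ α β → Additive (diamondOp α β)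
diamondOp-additive a a = ∘-additive (⊛ᴾ-additiveˡ (constᴾ ħ)) aOp-additive
diamondOp-additive a b = ∘-additive (wordOp-additive (a ∷ b ∷ [])) ⊝ᴾ-additive
diamondOp-additive b a = ∘-additive (wordOp-additive (a ∷ b ∷ [])) ⊝ᴾ-additive
diamondOp-additive b b = ∘-additive (wordOp-additive (b ∷ b ∷ [])) ⊝ᴾ-additive

eval-diamond : ∀ α β X → eval LiOp (diamond α β X) ≋ᴾ diamondOp α β (eval LiOp X)
eval-diamond a a X = Qqz.trans (eval-prefixL (a ∷ []) (hbarL X)) (⟦⟧-cong aOp-additive (eval-hbarL LiOp X))
eval-diamond a b X = Qqz.trans (eval-negL LiOp (prefixL (a ∷ b ∷ []) X)) (Qqz.-‿cong (eval-prefixL (a ∷ b ∷ []) X))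
eval-diamond b a X = Qqz.trans (eval-negL LiOp (prefixL (a ∷ b ∷ []) X)) (Qqz.-‿cong (eval-prefixL (a ∷ b ∷ []) X))
eval-diamond b b X = Qqz.trans (eval-negL LiOp (prefixL (b ∷ b ∷ []) X)) (Qqz.-‿cong (eval-prefixL (b ∷ b ∷ []) X))

eval-shq-∷ : ∀ α β w v →
  eval LiOp (shq (α ∷ w) (β ∷ v)) ≋ᴾ
    letterOp α (eval LiOp (shq w (β ∷ v))) ⊕ᴾ
      (letterOp β (eval LiOp (shq (α ∷ w) v)) ⊕ᴾ diamondOp α β (eval LiOp (shq w v)))
eval-shq-∷ α β w v =
  Qqz.trans (eval-++ LiOp (prefixL (α ∷ []) (shq w (β ∷ v))) _)
  (Qqz.+-cong (eval-prefixL (α ∷ []) (shq w (β ∷ v)))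
  (Qqz.trans (eval-++ LiOp (prefixL (β ∷ []) (shq (α ∷ w) v)) _)
  (Qqz.+-cong (eval-prefixL (β ∷ []) (shq (α ∷ w) v)) (eval-diamond α β (shq w v)))))

bracket-vanishes : ∀ g {u v w} → u ≋ 𝟘 → v ≋ 𝟘 → w ≋ 𝟘 → g ⊛ (u ⊕ (v ⊕ ħ ⊛ w)) ≋ 𝟘
bracket-vanishes g {u} {v} u≋𝟘 v≋𝟘 w≋𝟘 =
  Qq.trans (⊛-congˡ g (Qq.+-cong {u} {𝟘} u≋𝟘 (Qq.+-cong {v} {𝟘} v≋𝟘 (Qq.trans (⊛-congˡ ħ w≋𝟘) (Qq.zeroʳ ħ)))))
  (Qq.trans (⊛-congˡ g (Qq.trans (Qq.+-identityˡ (𝟘 ⊕ 𝟘)) (Qq.+-identityˡ 𝟘))) (Qq.zeroʳ g))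

aOp-coeff-product : ∀ {X Y} → X 0 ≋ 𝟘 → Y 0 ≋ 𝟘 → ∀ i j →
  aOp X i ⊛ aOp Y j ≋ qfrac (i ℕ.+ j) ⊛ (X i ⊛ aOp Y j ⊕ (aOp X i ⊛ Y j ⊕ ħ ⊛ (X i ⊛ Y j)))
aOp-coeff-product {X} {Y} X₀ Y₀ zero j =
  Qq.trans (Qq.zeroˡ (aOp Y j))
           (Qq.sym (bracket-vanishes (qfrac j) (zero-left (aOp Y j) X₀) (Qq.zeroˡ (Y j)) (zero-left (Y j) X₀)))
  where
  zero-left : ∀ y {x} → x ≋ 𝟘 → x ⊛ y ≋ 𝟘
  zero-left y x≋𝟘 = Qq.trans (⊛-congʳ y x≋𝟘) (Qq.zeroˡ y)
aOp-coeff-product {X} {Y} X₀ Y₀ (suc i) zero =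
  Qq.trans (Qq.zeroʳ (aOp X (suc i)))
           (Qq.sym (bracket-vanishes (qfrac (suc i ℕ.+ 0)) (Qq.zeroʳ (X (suc i)))
                                     (zero-right (aOp X (suc i)) Y₀) (zero-right (X (suc i)) Y₀)))
  where
  zero-right : ∀ x {y} → y ≋ 𝟘 → x ⊛ y ≋ 𝟘
  zero-right x y≋𝟘 = Qq.trans (⊛-congˡ x y≋𝟘) (Qq.zeroʳ x)
aOp-coeff-product {X} {Y} X₀ Y₀ (suc i) (suc j) = begin
  gi ⊛ xi ⊛ (gj ⊛ yj)             ≈⟨ solve 4 (λ gi xi gj yj → gi :* xi :* (gj :* yj) := gi :* gj :* (xi :* yj)) Qq.refl gi xi gj yj ⟩
  gi ⊛ gj ⊛ (xi ⊛ yj)             ≈⟨ ⊛-congʳ (xi ⊛ yj) (qfrac-product i j) ⟩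
  gN ⊛ (gj ⊕ gi ⊕ ħ) ⊛ (xi ⊛ yj)  ≈⟨ solve 6 (λ gN gi gj h xi yj → gN :* (gj :+ gi :+ h) :* (xi :* yj)
                                                 := gN :* (xi :* (gj :* yj) :+ (gi :* xi :* yj :+ h :* (xi :* yj))))
                                        Qq.refl gN gi gj ħ xi yj ⟩
  gN ⊛ (xi ⊛ (gj ⊛ yj) ⊕ (gi ⊛ xi ⊛ yj ⊕ ħ ⊛ (xi ⊛ yj))) ∎
  where
  open SetoidReasoning Qq.setoid
  open Qq-Solver using (solve; _:+_; _:*_; _:=_)
  gi = qfrac (suc i)
  gj = qfrac (suc j)
  gN = qfrac (suc i ℕ.+ suc j)
  xi = X (suc i)
  yj = Y (suc j)

aOp-⊛-aOp : ∀ {X Y} → X 0 ≋ 𝟘 → Y 0 ≋ 𝟘 →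
  aOp X ⊛ᴾ aOp Y ≋ᴾ aOp (X ⊛ᴾ aOp Y) ⊕ᴾ (aOp (aOp X ⊛ᴾ Y) ⊕ᴾ aOp (constᴾ ħ ⊛ᴾ (X ⊛ᴾ Y)))
aOp-⊛-aOp X₀ Y₀ zero = Qq.trans (Qq.zeroˡ 𝟘) (Qq.sym (Qq.trans (Qq.+-identityˡ (𝟘 ⊕ 𝟘)) (Qq.+-identityˡ 𝟘)))
aOp-⊛-aOp {X} {Y} X₀ Y₀ (suc M) = begin
  Σᴾ≤ N (λ i → aOp X i ⊛ aOp Y (N ∸ i))
    ≈⟨ Σᴾ≤-congᵇ N (λ i i≤N → Qq.trans (aOp-coeff-product X₀ Y₀ i (N ∸ i))
                                        (⊛-congʳ (bracket i (N ∸ i)) (Qq.reflexive (≡.cong qfrac (ℕₚ.m+[n∸m]≡n i≤N))))) ⟩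
  Σᴾ≤ N (λ i → g ⊛ bracket i (N ∸ i))
    ≈⟨ *-distribˡ-Σᴾ≤ N g (λ i → bracket i (N ∸ i)) ⟨
  g ⊛ Σᴾ≤ N (λ i → bracket i (N ∸ i))
    ≈⟨ ⊛-congˡ g (Qq.trans (Σᴾ≤-distrib-+ N _ _) (Qq.+-congˡ {ΣA} (Σᴾ≤-distrib-+ N _ _))) ⟩
  g ⊛ (ΣA ⊕ (ΣB ⊕ Σᴾ≤ N (λ i → ħ ⊛ (X i ⊛ Y (N ∸ i)))))
    ≈⟨ ⊛-congˡ g (Qq.+-congˡ {ΣA} (Qq.+-congˡ {ΣB} (*-distribˡ-Σᴾ≤ N ħ _))) ⟨
  g ⊛ (ΣA ⊕ (ΣB ⊕ ħ ⊛ ΣC))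
    ≈⟨ solve 5 (λ g u v h w → g :* (u :+ (v :+ h :* w)) := g :* u :+ (g :* v :+ g :* (h :* w))) Qq.refl g ΣA ΣB ħ ΣC ⟩
  g ⊛ ΣA ⊕ (g ⊛ ΣB ⊕ g ⊛ (ħ ⊛ ΣC))
    ≈⟨ Qq.+-congˡ {g ⊛ ΣA} (Qq.+-congˡ {g ⊛ ΣB} (⊛-congˡ g (constᴾ-⊛ ħ (X ⊛ᴾ Y) N))) ⟨
  g ⊛ ΣA ⊕ (g ⊛ ΣB ⊕ g ⊛ (constᴾ ħ ⊛ᴾ (X ⊛ᴾ Y)) N)
    ∎
  where
  open SetoidReasoning Qq.setoid
  open Qq-Solver using (solve; _:+_; _:*_; _:=_)
  N = suc M
  g = qfrac N
  bracket : ℕ → ℕ → Series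
  bracket i j = X i ⊛ aOp Y j ⊕ (aOp X i ⊛ Y j ⊕ ħ ⊛ (X i ⊛ Y j))
  ΣA = Σᴾ≤ N (λ i → X i ⊛ aOp Y (N ∸ i))
  ΣB = Σᴾ≤ N (λ i → aOp X i ⊛ Y (N ∸ i))
  ΣC = Σᴾ≤ N (λ i → X i ⊛ Y (N ∸ i))

-- aOp only obeys the shuffle relation on series without constant term in z (qfrac 0 is junk).
Admissible : Letter → PS → Set
Admissible a X = X 0 ≋ 𝟘
Admissible b X = ⊤

letterOp-shuffle : ∀ α β {X Y} → Admissible α X → Admissible β Y →
  letterOp α X ⊛ᴾ letterOp β Y ≋ᴾ
    letterOp α (X ⊛ᴾ letterOp β Y) ⊕ᴾ (letterOp β (letterOp α X ⊛ᴾ Y) ⊕ᴾ diamondOp α β (X ⊛ᴾ Y))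
letterOp-shuffle a a X₀ Y₀ = aOp-⊛-aOp X₀ Y₀
letterOp-shuffle a b {X} {Y} _ _ = shuffle-ab aOp (⟦⟧-cong aOp-additive) z/[1-z] X Y
letterOp-shuffle b a {X} {Y} _ _ = shuffle-ba aOp (⟦⟧-cong aOp-additive) z/[1-z] X Y
letterOp-shuffle b b {X} {Y} _ _ = shuffle-bb z/[1-z] X Y

data H¹ : ABWord → Set where
  []  : H¹ []
  b∷_ : ∀ {u} → H¹ u → H¹ (b ∷ u)
  a∷_ : ∀ {α u} → H¹ (α ∷ u) → H¹ (a ∷ α ∷ u)

H¹-tail : ∀ {α u} → H¹ (α ∷ u) → H¹ u
H¹-tail (b∷ h) = h
H¹-tail (a∷ h) = h

H¹-admissible : ∀ {α u} → H¹ (α ∷ u) → Admissible α (LiOp u)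
H¹-admissible (b∷ _) = tt
H¹-admissible (a∷_ {α} {u} _) = letterOp-zero α (LiOp u)

LiOp-shuffle : ∀ {u v} → H¹ u → H¹ v → LiOp u ⊛ᴾ LiOp v ≋ᴾ eval LiOp (shq u v)
LiOp-shuffle {[]}    {v}     _ _ = Qqz.trans (Qqz.*-identityˡ (LiOp v)) (Qqz.sym (eval-single LiOp v))
LiOp-shuffle {α ∷ w} {[]}    _ _ = Qqz.trans (Qqz.*-identityʳ (LiOp (α ∷ w))) (Qqz.sym (eval-single LiOp (α ∷ w)))
LiOp-shuffle {α ∷ w} {β ∷ v} u∈H¹ v∈H¹ = begin
  letterOp α (LiOp w) ⊛ᴾ letterOp β (LiOp v)
    ≈⟨ letterOp-shuffle α β (H¹-admissible u∈H¹) (H¹-admissible v∈H¹) ⟩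
  letterOp α (LiOp w ⊛ᴾ LiOp (β ∷ v)) ⊕ᴾ
    (letterOp β (LiOp (α ∷ w) ⊛ᴾ LiOp v) ⊕ᴾ diamondOp α β (LiOp w ⊛ᴾ LiOp v))
    ≈⟨ Qqz.+-cong (⟦⟧-cong (letterOp-additive α) (LiOp-shuffle (H¹-tail u∈H¹) v∈H¹))
         (Qqz.+-cong (⟦⟧-cong (letterOp-additive β) (LiOp-shuffle u∈H¹ (H¹-tail v∈H¹)))
                     (⟦⟧-cong (diamondOp-additive α β) (LiOp-shuffle (H¹-tail u∈H¹) (H¹-tail v∈H¹)))) ⟩
  letterOp α (eval LiOp (shq w (β ∷ v))) ⊕ᴾ
    (letterOp β (eval LiOp (shq (α ∷ w) v)) ⊕ᴾ diamondOp α β (eval LiOp (shq w v)))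
    ≈⟨ eval-shq-∷ α β w v ⟨
  eval LiOp (shq (α ∷ w) (β ∷ v))
    ∎
  where open SetoidReasoning Qqz.setoid

wordOp-eWord : ∀ k F → wordOp (eWord k) F ≡ wordOp (replicate k a) (z/[1-z] ⊛ᴾ F)
wordOp-eWord zero    F = ≡.refl
wordOp-eWord (suc k) F = ≡.cong aOp (wordOp-eWord k F)

wordOp-aⁿ : ∀ k F M → wordOp (replicate k a) F (suc M) ≋ qfrac (suc M) ^ k ⊛ F (suc M)
wordOp-aⁿ zero    F M = Qq.sym (Qq.*-identityˡ (F (suc M)))
wordOp-aⁿ (suc k) F M =
  Qq.trans (⊛-congˡ (qfrac (suc M)) (wordOp-aⁿ k F M))
           (Qq.sym (Qq.*-assoc (qfrac (suc M)) (qfrac (suc M) ^ k) (F (suc M))))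

z/[1-z]-coeff : ∀ F M → (z/[1-z] ⊛ᴾ F) (suc M) ≋ Σᴾ≤ M F
z/[1-z]-coeff F M = begin
  Σᴾ≤ (suc M) (λ i → z/[1-z] i ⊛ F (suc M ∸ i))   ≈⟨ Σᴾ≤-suc M _ ⟩
  𝟘 ⊛ F (suc M) ⊕ Σᴾ≤ M (λ i → 𝟙 ⊛ F (M ∸ i))     ≈⟨ Qq.+-cong (Qq.zeroˡ (F (suc M)))
                                                         (Σᴾ≤-cong M (λ i → Qq.*-identityˡ (F (M ∸ i)))) ⟩
  𝟘 ⊕ Σᴾ≤ M (λ i → F (M ∸ i))                     ≈⟨ Qq.+-identityˡ _ ⟩
  Σᴾ≤ M (λ i → F (M ∸ i))                         ≈⟨ Σᴾ≤-reverse M F ⟨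
  Σᴾ≤ M F                                         ∎
  where open SetoidReasoning Qq.setoid

sumS-applyUpTo : ∀ M (G : ℕ → Series) → G 0 ⊕ sumS (applyUpTo (G ∘ suc) M) ≋ Σᴾ≤ M G
sumS-applyUpTo zero    G = Qq.+-identityʳ (G 0)
sumS-applyUpTo (suc M) G = Qq.trans (Qq.+-congˡ {G 0} (sumS-applyUpTo M (G ∘ suc))) (Qq.sym (Σᴾ≤-suc M G))

tailSum-suc : ∀ ks M → tailSum ks (suc M) ≋ Σᴾ≤ M (LiWord ks)
tailSum-suc []       M = Qq.trans oneS≋𝟙 (Qq.sym (Qq.trans (Σᴾ≤-head M (LiWord []) (λ _ _ → ≡.refl)) oneS≋𝟙))
tailSum-suc (k ∷ ks) M = begin
  sumS (map H (map suc (upTo M)))       ≡⟨ ≡.cong sumS (≡.trans (≡.cong (map H) (map-upTo suc M)) (map-applyUpTo suc H M)) ⟩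
  sumS (applyUpTo (H ∘ suc) M)          ≈⟨ Qq.+-identityˡ _ ⟨
  𝟘 ⊕ sumS (applyUpTo (H ∘ suc) M)      ≈⟨ sumS-applyUpTo M (LiWord (k ∷ ks)) ⟩
  Σᴾ≤ M (LiWord (k ∷ ks))               ∎
  where
  open SetoidReasoning Qq.setoid
  H : ℕ → Series
  H m = factor k m *S tailSum ks m

LiWord-[] : LiWord [] ≋ᴾ 𝟙ᴾ
LiWord-[] zero    = oneS≋𝟙
LiWord-[] (suc _) = Qq.refl

LiWord-∷ : ∀ k ks → LiWord (k ∷ ks) ≋ᴾ wordOp (eWord k) (LiWord ks)
LiWord-∷ zero    ks zero    = Qq.sym (letterOp-zero b (LiWord ks))
LiWord-∷ (suc k) ks zero    = Qq.refl
LiWord-∷ k       ks (suc M) = begin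
  factor k (suc M) *S tailSum ks (suc M)                  ≈⟨ *S≋⊛ (factor k (suc M)) (tailSum ks (suc M)) ⟩
  factor k (suc M) ⊛ tailSum ks (suc M)                   ≈⟨ Qq.*-cong (factor≋qfrac^ k (suc M)) (tailSum-suc ks M) ⟩
  qfrac (suc M) ^ k ⊛ Σᴾ≤ M (LiWord ks)                   ≈⟨ ⊛-congˡ (qfrac (suc M) ^ k) (z/[1-z]-coeff (LiWord ks) M) ⟨
  qfrac (suc M) ^ k ⊛ (z/[1-z] ⊛ᴾ LiWord ks) (suc M)      ≈⟨ wordOp-aⁿ k (z/[1-z] ⊛ᴾ LiWord ks) M ⟨
  wordOp (replicate k a) (z/[1-z] ⊛ᴾ LiWord ks) (suc M)  ≡⟨ ≡.cong (λ F → F (suc M)) (wordOp-eWord k (LiWord ks)) ⟨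
  wordOp (eWord k) (LiWord ks) (suc M)                    ∎
  where open SetoidReasoning Qq.setoid

LiOp-toAB : ∀ ks → LiOp (toAB ks) ≋ᴾ LiWord ks
LiOp-toAB []       = Qqz.sym LiWord-[]
LiOp-toAB (k ∷ ks) = begin
  LiOp (eWord k ++ toAB ks)           ≡⟨ wordOp-++ (eWord k) (toAB ks) 𝟙ᴾ ⟩
  wordOp (eWord k) (LiOp (toAB ks))   ≈⟨ ⟦⟧-cong (wordOp-additive (eWord k)) (LiOp-toAB ks) ⟩
  wordOp (eWord k) (LiWord ks)        ≈⟨ LiWord-∷ k ks ⟨
  LiWord (k ∷ ks)                     ∎
  where open SetoidReasoning Qqz.setoid

H¹-eWord : ∀ k {r} → H¹ r → H¹ (eWord k ++ r)
H¹-eWord zero          r∈H¹ = b∷ r∈H¹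
H¹-eWord (suc zero)    r∈H¹ = a∷ b∷ r∈H¹
H¹-eWord (suc (suc k)) r∈H¹ = a∷ H¹-eWord (suc k) r∈H¹

H¹-toAB : ∀ ks → H¹ (toAB ks)
H¹-toAB []       = []
H¹-toAB (k ∷ ks) = H¹-eWord k (H¹-toAB ks)

wordOp-aⁿ-aOp : ∀ n F → wordOp (replicate n a) (aOp F) ≡ aOp (wordOp (replicate n a) F)
wordOp-aⁿ-aOp zero    F = ≡.refl
wordOp-aⁿ-aOp (suc n) F = ≡.cong aOp (wordOp-aⁿ-aOp n F)

wordOp-a⁺-𝟙 : ∀ n → wordOp (replicate (suc n) a) 𝟙ᴾ ≋ᴾ 𝟘ᴾ
wordOp-a⁺-𝟙 n zero    = Qq.refl
wordOp-a⁺-𝟙 n (suc M) = Qq.trans (wordOp-aⁿ (suc n) 𝟙ᴾ M) (Qq.zeroʳ (qfrac (suc M) ^ suc n))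

parseGo-sound : ∀ n u → maybe′ LiWord zeroP (parseGo n u) ≋ᴾ wordOp (replicate n a) (LiOp u)
parseGo-sound zero    []      = LiWord-[]
parseGo-sound (suc n) []      = Qqz.sym (wordOp-a⁺-𝟙 n)
parseGo-sound zero    (a ∷ w) = parseGo-sound 1 w
parseGo-sound (suc n) (a ∷ w) =
  Qqz.trans (parseGo-sound (suc (suc n)) w) (Qqz.reflexive (≡.sym (wordOp-aⁿ-aOp (suc n) (LiOp w))))
parseGo-sound zero    (b ∷ w) with parseGo zero w | parseGo-sound zero w
... | just ks | ks≋w = Qqz.trans (LiWord-∷ zero ks) (⊛ᴾ-congˡ z/[1-z] ks≋w)
... | nothing | 𝟘≋w = Qqz.sym (Qqz.trans (⊛ᴾ-congˡ z/[1-z] (Qqz.sym 𝟘≋w)) (Qqz.zeroʳ z/[1-z]))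
parseGo-sound (suc n) (b ∷ w) with parseGo zero w | parseGo-sound zero w
... | just ks | ks≋w =
  Qqz.trans (LiWord-∷ (suc n) ks)
  (Qqz.trans (Qqz.reflexive (wordOp-eWord (suc n) (LiWord ks)))
             (⟦⟧-cong (wordOp-additive (replicate (suc n) a)) (⊛ᴾ-congˡ z/[1-z] ks≋w)))
... | nothing | 𝟘≋w =
  Qqz.sym (Qqz.trans (⟦⟧-cong (wordOp-additive (replicate (suc n) a))
                               (Qqz.trans (⊛ᴾ-congˡ z/[1-z] (Qqz.sym 𝟘≋w)) (Qqz.zeroʳ z/[1-z])))
                     (ε-homo (wordOp-additive (replicate (suc n) a))))

LiAB≋maybe : ∀ u → LiAB u ≋ᴾ maybe′ LiWord zeroP (parse u)
LiAB≋maybe u with parse u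
... | just ks = Qqz.refl
... | nothing = Qqz.refl

LiAB≋LiOp : ∀ u → LiAB u ≋ᴾ LiOp u
LiAB≋LiOp u = Qqz.trans (LiAB≋maybe u) (parseGo-sound zero u)

term-scalar : ∀ {W : Set} (L : W → PS) e′ c′ e c w →
  term L (e′ ℤ.+ e , c′ ℚ.* c , w) ≋ᴾ constᴾ (scalar e′ c′) ⊛ᴾ term L (e , c , w)
term-scalar L e′ c′ e c w =
  Qqz.trans (⊛ᴾ-congʳ (L w) (Qqz.trans (constᴾ-cong (scalar-*-homo e′ e c′ c)) (constᴾ-*-homo (scalar e′ c′) (scalar e c))))
            (Qqz.*-assoc (constᴾ (scalar e′ c′)) (constᴾ (scalar e c)) (L w))

LiWord-shuffle : ∀ x y → LiWord x ⊛ᴾ LiWord y ≋ᴾ eval LiOp (shq (toAB x) (toAB y))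
LiWord-shuffle x y =
  Qqz.trans (Qqz.*-cong (Qqz.sym (LiOp-toAB x)) (Qqz.sym (LiOp-toAB y))) (LiOp-shuffle (H¹-toAB x) (H¹-toAB y))

eval-shqLin : ∀ X Y → eval LiWord X ⊛ᴾ eval LiWord Y ≋ᴾ eval LiOp (shqLin X Y)
eval-shqLin X Y = Qqz.sym (eval-concatMap {L = LiWord} {LiOp} (⊛ᴾ-additiveʳ (eval LiWord Y)) _
  (λ (e₁ , c₁ , x) → eval-concatMap {L = LiWord} {LiOp} (⊛ᴾ-additiveˡ (term LiWord (e₁ , c₁ , x))) _
    (λ (e₂ , c₂ , y) → term-product e₁ c₁ x e₂ c₂ y) Y) X)
  where
  term-product : ∀ e₁ c₁ x e₂ c₂ y →
    eval LiOp (map (λ (e , c , u) → (e₁ ℤ.+ e₂ ℤ.+ e , c₁ ℚ.* c₂ ℚ.* c , u)) (shq (toAB x) (toAB y)))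
      ≋ᴾ term LiWord (e₁ , c₁ , x) ⊛ᴾ term LiWord (e₂ , c₂ , y)
  term-product e₁ c₁ x e₂ c₂ y = begin
    eval LiOp (map _ (shq (toAB x) (toAB y)))
      ≈⟨ eval-map {L = LiOp} {LiOp} (⊛ᴾ-additiveˡ (constᴾ S₁₂)) _
           (λ (e , c , u) → term-scalar LiOp (e₁ ℤ.+ e₂) (c₁ ℚ.* c₂) e c u) (shq (toAB x) (toAB y)) ⟩
    constᴾ S₁₂ ⊛ᴾ eval LiOp (shq (toAB x) (toAB y))
      ≈⟨ Qqz.*-cong (Qqz.trans (constᴾ-cong (scalar-*-homo e₁ e₂ c₁ c₂)) (constᴾ-*-homo S₁ S₂)) (Qqz.sym (LiWord-shuffle x y)) ⟩
    constᴾ S₁ ⊛ᴾ constᴾ S₂ ⊛ᴾ (LiWord x ⊛ᴾ LiWord y)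
      ≈⟨ solve 4 (λ s₁ s₂ u v → s₁ :* s₂ :* (u :* v) := s₁ :* u :* (s₂ :* v)) Qqz.refl
               (constᴾ S₁) (constᴾ S₂) (LiWord x) (LiWord y) ⟩
    constᴾ S₁ ⊛ᴾ LiWord x ⊛ᴾ (constᴾ S₂ ⊛ᴾ LiWord y)
      ∎
    where
    open SetoidReasoning Qqz.setoid
    open Qqz-Solver using (solve; _:*_; _:=_)
    S₁ = scalar e₁ c₁
    S₂ = scalar e₂ c₂
    S₁₂ = scalar (e₁ ℤ.+ e₂) (c₁ ℚ.* c₂)

theorem3p18 : (w v : Lin H1Word) →
    (Liq w *P Liq v) ≈P LiLin LiAB (shqLin w v)
theorem3p18 w v = begin
  Liq w *P Liq v                    ≈⟨ *P≋⊛ᴾ (Liq w) (Liq v) ⟩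
  Liq w ⊛ᴾ Liq v                    ≈⟨ Qqz.*-cong (LiLin≋eval LiWord w) (LiLin≋eval LiWord v) ⟩
  eval LiWord w ⊛ᴾ eval LiWord v    ≈⟨ eval-shqLin w v ⟩
  eval LiOp (shqLin w v)            ≈⟨ eval-cong (λ u → Qqz.sym (LiAB≋LiOp u)) (shqLin w v) ⟩
  eval LiAB (shqLin w v)            ≈⟨ LiLin≋eval LiAB (shqLin w v) ⟨
  LiLin LiAB (shqLin w v)           ∎
  where open SetoidReasoning Qqz.setoid
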